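{- Let $V=V(4,3)=\mathbb{F}_3^4$ and let $(M,G,V,\mathcal{E})$ be a homogeneous factorisation of $K_{81}=(V,E)$ of index $5$ with factors $\Gamma_b=\mathrm{Cay}(V,S_b)$ ($1\le b\le5$), in which $M$ is arc-transitive on each factor, where $G=T\rtimes G_0$ is affine $2$-transitive on $V$ with $G_0\le GL(4,3)$ having a normal extraspecial subgroup $\mathbf{E}$ of order $2^5$ with $G_0/\mathbf{E}$ isomorphic to a subgroup of $S_5$, and $M=T\rtimes\mathbf{E}$. Then $\Gamma_b\cong H(9,2)$ for all $b$.
   Context: A homogeneous factorisation of index $k>1$ of $K_n=(V,E)$ is a 4-tuple $(M,G,V,\mathcal{E})$ where $\mathcal{E}$ partitions the 2-subsets of $V$ into $k$ parts, $G\le\mathrm{Sym}(V)$ is transitive on $V$, leaves $\mathcal{E}$ invariant and permutes its parts transitively, and the kernel $M$ of this action is transitive on $V$; factors are $(V,E_i)$. $T$ is the translation group of $V$. $\mathrm{Cay}(V,S)$ has edges $\{u,v\}$ with $v-u\in S$. The Hamming graph $H(9,2)$ has vertices the pairs from a 9-element set, adjacent iff they differ in exactly one coordinate. -}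

module Defs where

open import Data.Fin using (Fin)
open import Data.Nat using (ℕ)
open import Data.Vec using (Vec; []; _∷_; map; zipWith; foldr′; transpose)
open import Data.Product using (Σ; _×_; _,_; ∃)
open import Data.List using (List; length)
open import Data.List.Relation.Unary.Unique.Propositional using (Unique)
open import Data.List.Membership.Propositional using (_∈_)
open import Relation.Binary.PropositionalEquality using (_≡_)
open import Relation.Nullary using (¬_)
open import Function.Bundles using (_⇔_)

data F3 : Set where
  𝟘 𝟙 𝟚 : F3

_+₃_ : F3 → F3 → F3
𝟘 +₃ y = y
𝟙 +₃ 𝟘 = 𝟙
𝟙 +₃ 𝟙 = 𝟚
𝟙 +₃ 𝟚 = 𝟘
𝟚 +₃ 𝟘 = 𝟚
𝟚 +₃ 𝟙 = 𝟘
𝟚 +₃ 𝟚 = 𝟙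

_*₃_ : F3 → F3 → F3
𝟘 *₃ y = 𝟘
𝟙 *₃ y = y
𝟚 *₃ 𝟘 = 𝟘
𝟚 *₃ 𝟙 = 𝟚
𝟚 *₃ 𝟚 = 𝟙

V : Set
V = Vec F3 4

Mat : Set
Mat = Vec V 4

0V : V
0V = 𝟘 ∷ 𝟘 ∷ 𝟘 ∷ 𝟘 ∷ []

_⊕_ : V → V → V
_⊕_ = zipWith _+₃_

dot : {n : ℕ} → Vec F3 n → Vec F3 n → F3
dot u v = foldr′ _+₃_ 𝟘 (zipWith _*₃_ u v)

_·_ : Mat → V → V
A · v = map (λ r → dot r v) A

_⊗_ : Mat → Mat → Mat
A ⊗ B = map (λ r → map (dot r) (transpose B)) A

I₄ : Mat
I₄ = (𝟙 ∷ 𝟘 ∷ 𝟘 ∷ 𝟘 ∷ [])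
   ∷ (𝟘 ∷ 𝟙 ∷ 𝟘 ∷ 𝟘 ∷ [])
   ∷ (𝟘 ∷ 𝟘 ∷ 𝟙 ∷ 𝟘 ∷ [])
   ∷ (𝟘 ∷ 𝟘 ∷ 𝟘 ∷ 𝟙 ∷ [])
   ∷ []

-- the affine map v ↦ A v + t; the group T ⋊ H consists of the maps
-- aff A t with A ∈ H and t ∈ V
aff : Mat → V → V → V
aff A t v = (A · v) ⊕ t

HasSize : {A : Set} → (A → Set) → ℕ → Set
HasSize {A} P n =
  Σ (List A) λ xs → length xs ≡ n × Unique xs × (∀ x → (P x ⇔ (x ∈ xs)))

record IsSubgroupGL (H : Mat → Set) : Set where
  field
    id∈   : H I₄
    mul∈  : ∀ {A B} → H A → H B → H (A ⊗ B)
    inv∈  : ∀ {A} → H A → Σ Mat λ B → H B × (A ⊗ B ≡ I₄) × (B ⊗ A ≡ I₄)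

record IsNormalSubgroup (K H : Mat → Set) : Set where
  field
    sub    : ∀ {A} → K A → H A
    normal : ∀ {A A' B} → H A → A ⊗ A' ≡ I₄ → K B → K ((A ⊗ B) ⊗ A')

Centre : (Mat → Set) → Mat → Set
Centre H z = H z × (∀ x → H x → z ⊗ x ≡ x ⊗ z)

-- Extraspecial 2-group of order 2^5: |E| = 32, |Z(E)| = 2 and
-- E / Z(E) is (nontrivial) elementary abelian.
record IsExtraspecial32 (E : Mat → Set) : Set where
  field
    order      : HasSize E 32
    centreSize : HasSize (Centre E) 2
    quotAbel   : ∀ x y → E x → E y →
                   Σ Mat λ z → Centre E z × (x ⊗ y ≡ (y ⊗ x) ⊗ z)
    quotExp2   : ∀ x → E x → Centre E (x ⊗ x)

Perm5 : Set
Perm5 = Fin 5 → Fin 5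

_≈₅_ : Perm5 → Perm5 → Set
σ ≈₅ τ = ∀ i → σ i ≡ τ i

-- H / K is isomorphic to a subgroup of S_5: there is a homomorphism
-- from H into Sym(5) whose kernel is exactly K.
QuotEmbedsS5 : (H K : Mat → Set) → Set
QuotEmbedsS5 H K =
  Σ (Mat → Perm5) λ φ →
    (∀ {A} → H A → Σ Perm5 λ ψ → ∀ i → (ψ (φ A i) ≡ i) × (φ A (ψ i) ≡ i))
    × (∀ {A B} → H A → H B → φ (A ⊗ B) ≈₅ (λ i → φ A (φ B i)))
    × (∀ {A} → H A → ((φ A ≈₅ (λ i → i)) ⇔ K A))

Affine2Transitive : (Mat → Set) → Set
Affine2Transitive G₀ =
  ∀ u v u' v' → ¬ (u ≡ v) → ¬ (u' ≡ v') →
    Σ Mat λ A → Σ V λ t → G₀ A × aff A t u ≡ u' × aff A t v ≡ v'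

-- The partition ℰ of the 2-subsets of V into 5 parts is given by a
-- symmetric colouring c : V → V → Fin 5 (the value c u u is irrelevant);
-- the part E_b is the set of pairs {u,v}, u ≠ v, with c u v ≡ b.

Symmetric : (V → V → Fin 5) → Set
Symmetric c = ∀ u v → c u v ≡ c v u

MapsPart : (V → V → Fin 5) → Mat → V → Fin 5 → Fin 5 → Set
MapsPart c A t b b' =
  ∀ u v → ¬ (u ≡ v) → c u v ≡ b → c (aff A t u) (aff A t v) ≡ b'

FixesParts : (V → V → Fin 5) → Mat → V → Set
FixesParts c A t =
  ∀ u v → ¬ (u ≡ v) → c (aff A t u) (aff A t v) ≡ c u v

Kernel : (Mat → Set) → (V → V → Fin 5) → Mat → V → Set
Kernel G₀ c A t = G₀ A × FixesParts c A t

record IsHomFact5 (G₀ : Mat → Set) (c : V → V → Fin 5) : Set where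
  field
    symm        : Symmetric c
    nonempty    : ∀ b → Σ V λ u → Σ V λ v → ¬ (u ≡ v) × c u v ≡ b
    invariant   : ∀ A t → G₀ A → Σ Perm5 λ σ →
                    (Σ Perm5 λ ψ → ∀ i → (ψ (σ i) ≡ i) × (σ (ψ i) ≡ i))
                    × (∀ b → MapsPart c A t b (σ b))
    G-trans     : ∀ u v → Σ Mat λ A → Σ V λ t → G₀ A × aff A t u ≡ v
    G-transParts : ∀ b b' → Σ Mat λ A → Σ V λ t → G₀ A × MapsPart c A t b b'
    M-trans     : ∀ u v → Σ Mat λ A → Σ V λ t → Kernel G₀ c A t × aff A t u ≡ v

FactorAdj : (V → V → Fin 5) → Fin 5 → V → V → Set
FactorAdj c b u v = ¬ (u ≡ v) × c u v ≡ b

ArcTransitive : (Mat → V → Set) → (V → V → Set) → Set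
ArcTransitive M R =
  ∀ u v u' v' → R u v → R u' v' →
    Σ Mat λ A → Σ V λ t → M A t × aff A t u ≡ u' × aff A t v ≡ v'

HammingAdj : (Fin 9 × Fin 9) → (Fin 9 × Fin 9) → Set
HammingAdj (a , b) (a' , b') =
  (¬ (a ≡ a') × b ≡ b') Data.Sum.⊎ (a ≡ a' × ¬ (b ≡ b'))
  where import Data.Sum

IsoToHamming : (V → V → Set) → Set
IsoToHamming R =
  Σ (V → Fin 9 × Fin 9) λ f →
  Σ (Fin 9 × Fin 9 → V) λ g →
    (∀ x → g (f x) ≡ x) × (∀ y → f (g y) ≡ y)
    × (∀ u v → (R u v ⇔ HammingAdj (f u) (f v)))

module Submission where

-- Translations lie in M, so the factor Γ_b is the Cayley graph Cay(V, S_b), and G₀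
-- permutes the five connection sets S_b transitively, so |S_b| = 16. The centre of E is
-- {1, z}; z commutes with G₀, which is transitive on nonzero vectors, so z = −1 and any
-- two elements of E commute or anticommute. Since |E| = 32 > |S_b|, some a ≠ 1 in E fixes
-- some s ∈ S_b; then a² = 1, and arc-transitivity of M forces S_b ⊆ (V₊ ∪ V₋) ∖ {0}, where
-- V₊ and V₋ are the eigenspaces of a for 1 and −1. An element of E anticommuting with a
-- swaps V₊ and V₋, and V = V₊ ⊕ V₋, so |V₊| = |V₋| = 9 and S_b = (V₊ ∪ V₋) ∖ {0}. The
-- coordinates V ≅ V₊ × V₋ ≅ Fin 9 × Fin 9 then carry Γ_b onto H(9,2).

open import Defs
open import Data.Empty using (⊥; ⊥-elim)
open import Data.Fin as Fin using (Fin; zero; suc; combine; remQuot; punchOut)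
import Data.Fin.Properties as Finₚ
open import Data.List as List using (List; []; _∷_; length; filter; _++_)
import Data.List.Properties as Listₚ
open import Data.List.Membership.Propositional using (_∈_; find)
open import Data.List.Membership.Propositional.Properties
  using (∈-lookup; ∈-filter⁺; ∈-filter⁻; ∈-++⁺ˡ; ∈-++⁺ʳ; ∈-++⁻; ∈-cartesianProductWith⁺)
open import Data.List.Relation.Unary.All as All using ([]; _∷_; all?)
open import Data.List.Relation.Unary.All.Properties using (¬All⇒Any¬)
open import Data.List.Relation.Unary.AllPairs using ([]; _∷_)
open import Data.List.Relation.Unary.Any as Any using (here; there)
import Data.List.Relation.Unary.Any.Properties as Anyₚ
open import Data.List.Relation.Unary.Unique.Propositional using (Unique)
import Data.List.Relation.Unary.Unique.Propositional.Properties as Uniqueₚ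
open import Data.Nat using (ℕ; _+_; _*_; _≤_; _<_; s≤s; _≤?_; _<?_)
import Data.Nat.Properties as ℕₚ
open import Data.Product using (_×_; _,_; proj₁; proj₂; Σ; ∃; ∃₂; uncurry)
open import Data.Product.Function.NonDependent.Propositional using (_×-⇔_)
open import Data.Sum as Sum using (_⊎_; inj₁; inj₂; [_,_]′)
open import Data.Sum.Function.Propositional using (_⊎-⇔_)
open import Data.Unit using (⊤; tt)
open import Data.Vec using (Vec; []; _∷_; map; zipWith; replicate; lookup; transpose; tabulate)
import Data.Vec.Properties as Vecₚ
open import Function.Base using (_∘_; id)
open import Function.Bundles using (_⇔_; mk⇔; Equivalence)
open Equivalence using (to; from)
import Function.Properties.Equivalence as ⇔
open import Relation.Binary.Definitions using (DecidableEquality)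
open import Relation.Binary.PropositionalEquality hiding ([_])
open ≡-Reasoning
open import Relation.Nullary using (¬_; Dec; yes; no; contradiction; ¬?)
open import Relation.Nullary.Decidable using (map′; _×-dec_; from-yes; from-no)
open import Relation.Unary using (Decidable)

infix 4 _≟₃_
_≟₃_ : DecidableEquality F3
𝟘 ≟₃ 𝟘 = yes refl
𝟘 ≟₃ 𝟙 = no λ ()
𝟘 ≟₃ 𝟚 = no λ ()
𝟙 ≟₃ 𝟘 = no λ ()
𝟙 ≟₃ 𝟙 = yes refl
𝟙 ≟₃ 𝟚 = no λ ()
𝟚 ≟₃ 𝟘 = no λ ()
𝟚 ≟₃ 𝟙 = no λ ()
𝟚 ≟₃ 𝟚 = yes refl

-₃_ : F3 → F3
-₃ 𝟘 = 𝟘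
-₃ 𝟙 = 𝟚
-₃ 𝟚 = 𝟙

-- Identities of F₃ are checked by evaluating both sides everywhere.
∀₃? : {P : F3 → Set} → (∀ x → Dec (P x)) → Dec (∀ x → P x)
∀₃? P? = map′ (λ { (p₀ , p₁ , p₂) → λ { 𝟘 → p₀ ; 𝟙 → p₁ ; 𝟚 → p₂ } })
              (λ p → p 𝟘 , p 𝟙 , p 𝟚)
              (P? 𝟘 ×-dec P? 𝟙 ×-dec P? 𝟚)

+₃-comm : ∀ x y → x +₃ y ≡ y +₃ x
+₃-comm = from-yes (∀₃? λ x → ∀₃? λ y → x +₃ y ≟₃ y +₃ x)

+₃-identityʳ : ∀ x → x +₃ 𝟘 ≡ x
+₃-identityʳ = from-yes (∀₃? λ x → x +₃ 𝟘 ≟₃ x)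

+₃-inverseʳ : ∀ x → x +₃ (-₃ x) ≡ 𝟘
+₃-inverseʳ = from-yes (∀₃? λ x → x +₃ (-₃ x) ≟₃ 𝟘)

+₃-medial : ∀ x y z w → (x +₃ y) +₃ (z +₃ w) ≡ (x +₃ z) +₃ (y +₃ w)
+₃-medial = from-yes (∀₃? λ x → ∀₃? λ y → ∀₃? λ z → ∀₃? λ w →
  (x +₃ y) +₃ (z +₃ w) ≟₃ (x +₃ z) +₃ (y +₃ w))

*₃-zeroʳ : ∀ x → x *₃ 𝟘 ≡ 𝟘
*₃-zeroʳ = from-yes (∀₃? λ x → x *₃ 𝟘 ≟₃ 𝟘)

*₃-identityʳ : ∀ x → x *₃ 𝟙 ≡ x
*₃-identityʳ = from-yes (∀₃? λ x → x *₃ 𝟙 ≟₃ x)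

*₃-assoc : ∀ x y z → (x *₃ y) *₃ z ≡ x *₃ (y *₃ z)
*₃-assoc = from-yes (∀₃? λ x → ∀₃? λ y → ∀₃? λ z → (x *₃ y) *₃ z ≟₃ x *₃ (y *₃ z))

*₃-distribˡ : ∀ x y z → x *₃ (y +₃ z) ≡ (x *₃ y) +₃ (x *₃ z)
*₃-distribˡ = from-yes (∀₃? λ x → ∀₃? λ y → ∀₃? λ z →
  x *₃ (y +₃ z) ≟₃ (x *₃ y) +₃ (x *₃ z))

*₃-distribʳ : ∀ x y z → (y +₃ z) *₃ x ≡ (y *₃ x) +₃ (z *₃ x)
*₃-distribʳ = from-yes (∀₃? λ x → ∀₃? λ y → ∀₃? λ z →
  (y +₃ z) *₃ x ≟₃ (y *₃ x) +₃ (z *₃ x))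

-₃-distrib-+₃ : ∀ x y → -₃ (x +₃ y) ≡ (-₃ x) +₃ (-₃ y)
-₃-distrib-+₃ = from-yes (∀₃? λ x → ∀₃? λ y → -₃ (x +₃ y) ≟₃ (-₃ x) +₃ (-₃ y))

*₃--₃ : ∀ x y → x *₃ (-₃ y) ≡ -₃ (x *₃ y)
*₃--₃ = from-yes (∀₃? λ x → ∀₃? λ y → x *₃ (-₃ y) ≟₃ -₃ (x *₃ y))

-₃-involutive : ∀ x → -₃ (-₃ x) ≡ x
-₃-involutive = from-yes (∀₃? λ x → -₃ (-₃ x) ≟₃ x)

infix  8 -ᵥ_
infixl 6 _+ᵥ_ _-ᵥ_

-- At n = 4, _+ᵥ_ and 0ᵥ are definitionally Defs._⊕_ and Defs.0V.
_+ᵥ_ : ∀ {n} → Vec F3 n → Vec F3 n → Vec F3 n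
_+ᵥ_ = zipWith _+₃_

-ᵥ_ : ∀ {n} → Vec F3 n → Vec F3 n
-ᵥ_ = map -₃_

_-ᵥ_ : ∀ {n} → Vec F3 n → Vec F3 n → Vec F3 n
u -ᵥ v = u +ᵥ -ᵥ v

0ᵥ : ∀ {n} → Vec F3 n
0ᵥ = replicate _ 𝟘

+ᵥ-comm : ∀ {n} (u v : Vec F3 n) → u +ᵥ v ≡ v +ᵥ u
+ᵥ-comm = Vecₚ.zipWith-comm +₃-comm

+ᵥ-identityˡ : ∀ {n} (u : Vec F3 n) → 0ᵥ +ᵥ u ≡ u
+ᵥ-identityˡ = Vecₚ.zipWith-identityˡ λ _ → refl

+ᵥ-identityʳ : ∀ {n} (u : Vec F3 n) → u +ᵥ 0ᵥ ≡ u
+ᵥ-identityʳ = Vecₚ.zipWith-identityʳ +₃-identityʳ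

u-u≡0 : ∀ {n} (u : Vec F3 n) → u -ᵥ u ≡ 0ᵥ
u-u≡0 = Vecₚ.zipWith-inverseʳ +₃-inverseʳ

-ᵥ-involutive : ∀ {n} (u : Vec F3 n) → -ᵥ -ᵥ u ≡ u
-ᵥ-involutive []      = refl
-ᵥ-involutive (x ∷ u) = cong₂ _∷_ (-₃-involutive x) (-ᵥ-involutive u)

u-v+v≡u : ∀ {n} (u v : Vec F3 n) → u -ᵥ v +ᵥ v ≡ u
u-v+v≡u []      []      = refl
u-v+v≡u (x ∷ u) (y ∷ v) = cong₂ _∷_
  (from-yes (∀₃? λ x → ∀₃? λ y → (x +₃ (-₃ y)) +₃ y ≟₃ x) x y) (u-v+v≡u u v)

u+v-v≡u : ∀ {n} (u v : Vec F3 n) → u +ᵥ v -ᵥ v ≡ u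
u+v-v≡u []      []      = refl
u+v-v≡u (x ∷ u) (y ∷ v) = cong₂ _∷_
  (from-yes (∀₃? λ x → ∀₃? λ y → (x +₃ y) +₃ (-₃ y) ≟₃ x) x y) (u+v-v≡u u v)

-[u-v]≡v-u : ∀ {n} (u v : Vec F3 n) → -ᵥ (u -ᵥ v) ≡ v -ᵥ u
-[u-v]≡v-u []      []      = refl
-[u-v]≡v-u (x ∷ u) (y ∷ v) = cong₂ _∷_
  (from-yes (∀₃? λ x → ∀₃? λ y → -₃ (x +₃ (-₃ y)) ≟₃ y +₃ (-₃ x)) x y) (-[u-v]≡v-u u v)

-[u+u]≡u : ∀ {n} (u : Vec F3 n) → -ᵥ (u +ᵥ u) ≡ u
-[u+u]≡u []      = refl
-[u+u]≡u (x ∷ u) = cong₂ _∷_ (from-yes (∀₃? λ x → -₃ (x +₃ x) ≟₃ x) x) (-[u+u]≡u u)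

u-v≡0⇒u≡v : ∀ {n} {u v : Vec F3 n} → u -ᵥ v ≡ 0ᵥ → u ≡ v
u-v≡0⇒u≡v {u = u} {v} u-v≡0 = begin
  u              ≡⟨ u-v+v≡u u v ⟨
  u -ᵥ v +ᵥ v    ≡⟨ cong (_+ᵥ v) u-v≡0 ⟩
  0ᵥ +ᵥ v        ≡⟨ +ᵥ-identityˡ v ⟩
  v              ∎

u+v≡0⇒u≡-v : ∀ {n} {u v : Vec F3 n} → u +ᵥ v ≡ 0ᵥ → u ≡ -ᵥ v
u+v≡0⇒u≡-v {u = u} {v} u+v≡0 = begin
  u              ≡⟨ u+v-v≡u u v ⟨
  u +ᵥ v -ᵥ v    ≡⟨ cong (_-ᵥ v) u+v≡0 ⟩
  0ᵥ -ᵥ v        ≡⟨ +ᵥ-identityˡ (-ᵥ v) ⟩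
  -ᵥ v           ∎

u≡-u⇒u≡0 : ∀ {n} {u : Vec F3 n} → u ≡ -ᵥ u → u ≡ 0ᵥ
u≡-u⇒u≡0 {u = u} u≡-u = begin
  u              ≡⟨ -[u+u]≡u u ⟨
  -ᵥ (u +ᵥ u)    ≡⟨ cong (λ w → -ᵥ (u +ᵥ w)) u≡-u ⟩
  -ᵥ (u -ᵥ u)    ≡⟨ cong -ᵥ_ (u-u≡0 u) ⟩
  -ᵥ 0ᵥ          ≡⟨ Vecₚ.map-replicate -₃_ 𝟘 _ ⟩
  0ᵥ             ∎

u≢v⇒v-u≢0 : ∀ {n} {u v : Vec F3 n} → u ≢ v → v -ᵥ u ≢ 0ᵥ
u≢v⇒v-u≢0 u≢v v-u≡0 = u≢v (sym (u-v≡0⇒u≡v v-u≡0))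

-[u+v]+-[u-v]≡u : ∀ {n} (u v : Vec F3 n) → -ᵥ (u +ᵥ v) +ᵥ -ᵥ (u -ᵥ v) ≡ u
-[u+v]+-[u-v]≡u []      []      = refl
-[u+v]+-[u-v]≡u (x ∷ u) (y ∷ v) = cong₂ _∷_
  (from-yes (∀₃? λ x → ∀₃? λ y → (-₃ (x +₃ y)) +₃ (-₃ (x +₃ (-₃ y))) ≟₃ x) x y)
  (-[u+v]+-[u-v]≡u u v)

-[[u+v]+[u-v]]≡u : ∀ {n} (u v : Vec F3 n) → -ᵥ ((u +ᵥ v) +ᵥ (u -ᵥ v)) ≡ u
-[[u+v]+[u-v]]≡u []      []      = refl
-[[u+v]+[u-v]]≡u (x ∷ u) (y ∷ v) = cong₂ _∷_
  (from-yes (∀₃? λ x → ∀₃? λ y → -₃ ((x +₃ y) +₃ (x +₃ (-₃ y))) ≟₃ x) x y)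
  (-[[u+v]+[u-v]]≡u u v)

-[[u+v]-[u-v]]≡v : ∀ {n} (u v : Vec F3 n) → -ᵥ ((u +ᵥ v) -ᵥ (u -ᵥ v)) ≡ v
-[[u+v]-[u-v]]≡v []      []      = refl
-[[u+v]-[u-v]]≡v (x ∷ u) (y ∷ v) = cong₂ _∷_
  (from-yes (∀₃? λ x → ∀₃? λ y → -₃ ((x +₃ y) +₃ (-₃ (x +₃ (-₃ y)))) ≟₃ y) x y)
  (-[[u+v]-[u-v]]≡v u v)

-[[u-v]+[u′-v′]]≡-[u+u′]--[v+v′] : ∀ {n} (u v u′ v′ : Vec F3 n) →
  -ᵥ ((u -ᵥ v) +ᵥ (u′ -ᵥ v′)) ≡ -ᵥ (u +ᵥ u′) -ᵥ -ᵥ (v +ᵥ v′)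
-[[u-v]+[u′-v′]]≡-[u+u′]--[v+v′] []      []      []        []        = refl
-[[u-v]+[u′-v′]]≡-[u+u′]--[v+v′] (x ∷ u) (y ∷ v) (x′ ∷ u′) (y′ ∷ v′) = cong₂ _∷_
  (from-yes (∀₃? λ x → ∀₃? λ y → ∀₃? λ x′ → ∀₃? λ y′ →
     -₃ ((x +₃ (-₃ y)) +₃ (x′ +₃ (-₃ y′))) ≟₃ (-₃ (x +₃ x′)) +₃ (-₃ (-₃ (y +₃ y′)))) x y x′ y′)
  (-[[u-v]+[u′-v′]]≡-[u+u′]--[v+v′] u v u′ v′)

-[[u-v]-[u′-v′]]≡-[u-u′]--[v-v′] : ∀ {n} (u v u′ v′ : Vec F3 n) →
  -ᵥ ((u -ᵥ v) -ᵥ (u′ -ᵥ v′)) ≡ -ᵥ (u -ᵥ u′) -ᵥ -ᵥ (v -ᵥ v′)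
-[[u-v]-[u′-v′]]≡-[u-u′]--[v-v′] []      []      []        []        = refl
-[[u-v]-[u′-v′]]≡-[u-u′]--[v-v′] (x ∷ u) (y ∷ v) (x′ ∷ u′) (y′ ∷ v′) = cong₂ _∷_
  (from-yes (∀₃? λ x → ∀₃? λ y → ∀₃? λ x′ → ∀₃? λ y′ →
     -₃ ((x +₃ (-₃ y)) +₃ (-₃ (x′ +₃ (-₃ y′))))
       ≟₃ (-₃ (x +₃ (-₃ x′))) +₃ (-₃ (-₃ (y +₃ (-₃ y′))))) x y x′ y′)
  (-[[u-v]-[u′-v′]]≡-[u-u′]--[v-v′] u v u′ v′)

dot-+ᵥʳ : ∀ {n} (r u v : Vec F3 n) → dot r (u +ᵥ v) ≡ dot r u +₃ dot r v
dot-+ᵥʳ []      []      []      = refl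
dot-+ᵥʳ (x ∷ r) (y ∷ u) (z ∷ v) rewrite dot-+ᵥʳ r u v | *₃-distribˡ x y z =
  +₃-medial (x *₃ y) (x *₃ z) (dot r u) (dot r v)

dot-+ᵥˡ : ∀ {n} (r s v : Vec F3 n) → dot (r +ᵥ s) v ≡ dot r v +₃ dot s v
dot-+ᵥˡ []      []      []      = refl
dot-+ᵥˡ (x ∷ r) (y ∷ s) (z ∷ v) rewrite dot-+ᵥˡ r s v | *₃-distribʳ z x y =
  +₃-medial (x *₃ z) (y *₃ z) (dot r v) (dot s v)

dot--ᵥʳ : ∀ {n} (r v : Vec F3 n) → dot r (-ᵥ v) ≡ -₃ dot r v
dot--ᵥʳ []      []      = refl
dot--ᵥʳ (x ∷ r) (y ∷ v) rewrite dot--ᵥʳ r v | *₃--₃ x y =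
  sym (-₃-distrib-+₃ (x *₃ y) (dot r v))

dot-0ᵥʳ : ∀ {n} (r : Vec F3 n) → dot r 0ᵥ ≡ 𝟘
dot-0ᵥʳ []      = refl
dot-0ᵥʳ (x ∷ r) rewrite dot-0ᵥʳ r | *₃-zeroʳ x = refl

dot-0ᵥˡ : ∀ {n} (v : Vec F3 n) → dot 0ᵥ v ≡ 𝟘
dot-0ᵥˡ []      = refl
dot-0ᵥˡ (x ∷ v) = dot-0ᵥˡ v

dot-scaleˡ : ∀ {n} x (r v : Vec F3 n) → dot (map (x *₃_) r) v ≡ x *₃ dot r v
dot-scaleˡ x []      []      = sym (*₃-zeroʳ x)
dot-scaleˡ x (y ∷ r) (z ∷ v) rewrite dot-scaleˡ x r v | *₃-assoc x y z =
  sym (*₃-distribˡ x (y *₃ z) (dot r v))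

basis : ∀ {n} → Fin n → Vec F3 n
basis zero    = 𝟙 ∷ 0ᵥ
basis (suc i) = 𝟘 ∷ basis i

dot-basisʳ : ∀ {n} (r : Vec F3 n) i → dot r (basis i) ≡ lookup r i
dot-basisʳ (x ∷ r) zero    rewrite dot-0ᵥʳ r | *₃-identityʳ x = +₃-identityʳ x
dot-basisʳ (x ∷ r) (suc i) rewrite *₃-zeroʳ x = dot-basisʳ r i

dot-transpose : ∀ {m k} (r : Vec F3 k) (B : Vec (Vec F3 m) k) v →
                dot (map (dot r) (transpose B)) v ≡ dot r (map (λ q → dot q v) B)
dot-transpose {m} [] [] v = begin
  dot (map (dot []) (replicate m [])) v  ≡⟨ cong (λ w → dot w v) (Vecₚ.map-replicate (dot []) [] m) ⟩
  dot 0ᵥ v                               ≡⟨ dot-0ᵥˡ v ⟩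
  𝟘                                      ∎
dot-transpose (x ∷ r) (q ∷ B) v = begin
  dot (map (dot (x ∷ r)) (transpose (q ∷ B))) v
    ≡⟨ cong (λ T → dot (map (dot (x ∷ r)) T) v) (Vecₚ.zipWith-is-⊛ _∷_ q (transpose B)) ⟨
  dot (map (dot (x ∷ r)) (zipWith _∷_ q (transpose B))) v
    ≡⟨ cong (λ w → dot w v) (map-dot-∷ q (transpose B)) ⟩
  dot (map (x *₃_) q +ᵥ map (dot r) (transpose B)) v
    ≡⟨ dot-+ᵥˡ (map (x *₃_) q) _ v ⟩
  dot (map (x *₃_) q) v +₃ dot (map (dot r) (transpose B)) v
    ≡⟨ cong₂ _+₃_ (dot-scaleˡ x q v) (dot-transpose r B v) ⟩
  (x *₃ dot q v) +₃ dot r (map (λ q → dot q v) B)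
    ∎
  where
  map-dot-∷ : ∀ {m} (q : Vec F3 m) T →
              map (dot (x ∷ r)) (zipWith _∷_ q T) ≡ map (x *₃_) q +ᵥ map (dot r) T
  map-dot-∷ []      []      = refl
  map-dot-∷ (y ∷ q) (t ∷ T) = cong (_ ∷_) (map-dot-∷ q T)

map-+₃ : ∀ {A : Set} {n} (f g : A → F3) (xs : Vec A n) →
         map (λ x → f x +₃ g x) xs ≡ map f xs +ᵥ map g xs
map-+₃ f g []       = refl
map-+₃ f g (x ∷ xs) = cong (_ ∷_) (map-+₃ f g xs)

·-⊕ : ∀ A u v → A · (u ⊕ v) ≡ (A · u) ⊕ (A · v)
·-⊕ A u v = trans (Vecₚ.map-cong (λ r → dot-+ᵥʳ r u v) A) (map-+₃ (λ r → dot r u) _ A)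

·--ᵥ : ∀ A v → A · (-ᵥ v) ≡ -ᵥ (A · v)
·--ᵥ A v = trans (Vecₚ.map-cong (λ r → dot--ᵥʳ r v) A) (Vecₚ.map-∘ -₃_ (λ r → dot r v) A)

·-distrib--ᵥ : ∀ A u v → A · (u -ᵥ v) ≡ A · u -ᵥ A · v
·-distrib--ᵥ A u v = trans (·-⊕ A u (-ᵥ v)) (cong (A · u +ᵥ_) (·--ᵥ A v))

·-0V : ∀ A → A · 0V ≡ 0V
·-0V A = trans (Vecₚ.map-cong dot-0ᵥʳ A) (Vecₚ.map-const A 𝟘)

·-⊗ : ∀ A B v → (A ⊗ B) · v ≡ A · (B · v)
·-⊗ A B v = trans (sym (Vecₚ.map-∘ (λ r → dot r v) _ A)) (Vecₚ.map-cong (λ r → dot-transpose r B v) A)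

I₄-· : ∀ v → I₄ · v ≡ v
I₄-· (x ∷ y ∷ z ∷ w ∷ []) rewrite +₃-identityʳ x | +₃-identityʳ y | +₃-identityʳ z | +₃-identityʳ w = refl

lookup-ext : ∀ {A : Set} {n} {xs ys : Vec A n} → (∀ i → lookup xs i ≡ lookup ys i) → xs ≡ ys
lookup-ext {xs = xs} {ys} eq = begin
  xs                    ≡⟨ Vecₚ.tabulate∘lookup xs ⟨
  tabulate (lookup xs)  ≡⟨ Vecₚ.tabulate-cong eq ⟩
  tabulate (lookup ys)  ≡⟨ Vecₚ.tabulate∘lookup ys ⟩
  ys                    ∎

-- Entry (k, i) of A is row k of A applied to the i-th basis vector.
·-ext : ∀ {A B} → (∀ v → A · v ≡ B · v) → A ≡ B
·-ext {A} {B} eq = lookup-ext λ k → lookup-ext λ i → begin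
  lookup (lookup A k) i       ≡⟨ dot-basisʳ (lookup A k) i ⟨
  dot (lookup A k) (basis i)  ≡⟨ Vecₚ.lookup-map k _ A ⟨
  lookup (A · basis i) k      ≡⟨ cong (λ w → lookup w k) (eq (basis i)) ⟩
  lookup (B · basis i) k      ≡⟨ Vecₚ.lookup-map k _ B ⟩
  dot (lookup B k) (basis i)  ≡⟨ dot-basisʳ (lookup B k) i ⟩
  lookup (lookup B k) i       ∎

lookup-injective : ∀ {A : Set} {xs : List A} → Unique xs →
                   ∀ {i j} → List.lookup xs i ≡ List.lookup xs j → i ≡ j
lookup-injective (_ ∷ _)   {zero}  {zero}  _ = refl
lookup-injective (x∉ ∷ _)  {zero}  {suc j} e = contradiction refl (All.lookup x∉ (subst (_∈ _) (sym e) (∈-lookup j)))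
lookup-injective (x∉ ∷ _)  {suc i} {zero}  e = contradiction refl (All.lookup x∉ (subst (_∈ _) e (∈-lookup i)))
lookup-injective (_ ∷ xs!) {suc i} {suc j} e = cong suc (lookup-injective xs! e)

-- A size witness yields mutually inverse maps between P and Fin n, so counting
-- arguments reduce to the injectivity lemmas of Data.Fin.Properties.
module _ {A : Set} {P : A → Set} where

  element : ∀ {n} → HasSize P n → Fin n → A
  element (xs , refl , _) = List.lookup xs

  element-P : ∀ {n} (s : HasSize P n) i → P (element s i)
  element-P (xs , refl , _ , mem) i = from (mem _) (∈-lookup i)

  element-injective : ∀ {n} (s : HasSize P n) {i j} → element s i ≡ element s j → i ≡ j
  element-injective (xs , refl , xs! , _) = lookup-injective xs!

  index : ∀ {n} → HasSize P n → ∀ {x} → P x → Fin n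
  index (xs , refl , _ , mem) p = Any.index (to (mem _) p)

  element-index : ∀ {n} (s : HasSize P n) {x} (p : P x) → element s (index s p) ≡ x
  element-index (xs , refl , _ , mem) p = sym (Anyₚ.lookup-index (to (mem _) p))

  index-injective : ∀ {n} (s : HasSize P n) {x y} (p : P x) (q : P y) → index s p ≡ index s q → x ≡ y
  index-injective s p q e = trans (sym (element-index s p)) (trans (cong (element s) e) (element-index s q))

  index-cong : ∀ {n} (s : HasSize P n) {x y} (p : P x) (q : P y) → x ≡ y → index s p ≡ index s q
  index-cong s p q e = element-injective s (trans (element-index s p) (trans e (sym (element-index s q))))

remQuot-injective : ∀ {m} n {i j : Fin (m * n)} → remQuot {m} n i ≡ remQuot n j → i ≡ j
remQuot-injective {m} n {i} {j} e = begin
  i                                  ≡⟨ Finₚ.combine-remQuot {m} n i ⟨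
  uncurry combine (remQuot {m} n i)  ≡⟨ cong (uncurry combine) e ⟩
  uncurry combine (remQuot {m} n j)  ≡⟨ Finₚ.combine-remQuot {m} n j ⟩
  j                                  ∎

combine-injective : ∀ {m n} {x y : Fin m × Fin n} → uncurry combine x ≡ uncurry combine y → x ≡ y
combine-injective {x = i , j} {k , l} e =
  cong₂ _,_ (Finₚ.combine-injectiveˡ i j k l e) (Finₚ.combine-injectiveʳ i j k l e)

×-injective⇒≤ : ∀ {m n k} (f : Fin m × Fin n → Fin k) → (∀ {x y} → f x ≡ f y → x ≡ y) → m * n ≤ k
×-injective⇒≤ {m} {n} f f-inj = Finₚ.injective⇒≤ {f = f ∘ remQuot {m} n} (remQuot-injective {m} n ∘ f-inj)

injective-×⇒≤ : ∀ {m n k} (f : Fin k → Fin m × Fin n) → (∀ {x y} → f x ≡ f y → x ≡ y) → k ≤ m * n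
injective-×⇒≤ f f-inj = Finₚ.injective⇒≤ {f = uncurry combine ∘ f} (f-inj ∘ combine-injective)

injective-avoiding⇒< : ∀ {m n} (f : Fin m → Fin n) {j} → (∀ {x y} → f x ≡ f y → x ≡ y) →
                       (∀ i → f i ≢ j) → m < n
injective-avoiding⇒< {n = ℕ.suc n} f {j} f-inj f≢j =
  s≤s (Finₚ.injective⇒≤ {f = λ i → punchOut (f≢j i ∘ sym)}
                          λ {x} {y} → f-inj ∘ Finₚ.punchOut-injective (f≢j x ∘ sym) (f≢j y ∘ sym))

MapsTo : ∀ {A B : Set} → (A → B) → (A → Set) → (B → Set) → Set
MapsTo f P Q = ∀ {x} → P x → Q (f x)

InjectiveOn : ∀ {A B : Set} → (A → B) → (A → Set) → Set
InjectiveOn f P = ∀ {x y} → P x → P y → f x ≡ f y → x ≡ y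

module _ {A B : Set} {P : A → Set} {Q : B → Set} {m n} (s : HasSize P m) (t : HasSize Q n)
         (f : A → B) (f-maps : MapsTo f P Q) where

  private
    f̂ : Fin m → Fin n
    f̂ i = index t (f-maps (element-P s i))

    element-f̂ : ∀ i → element t (f̂ i) ≡ f (element s i)
    element-f̂ i = element-index t _

    f̂-injective : InjectiveOn f P → ∀ {i j} → f̂ i ≡ f̂ j → i ≡ j
    f̂-injective f-inj {i} {j} e = element-injective s (f-inj (element-P s i) (element-P s j)
      (trans (sym (element-f̂ i)) (trans (cong (element t) e) (element-f̂ j))))

  size-≤ : InjectiveOn f P → m ≤ n
  size-≤ f-inj = Finₚ.injective⇒≤ (f̂-injective f-inj)

  size-< : InjectiveOn f P → ∀ {y} → Q y → (∀ {x} → P x → f x ≢ y) → m < n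
  size-< f-inj q f≢y = injective-avoiding⇒< f̂ (f̂-injective f-inj)
    λ i e → f≢y (element-P s i) (index-injective t _ q e)

  pigeonhole : n < m → ∃₂ λ x y → P x × P y × x ≢ y × f x ≡ f y
  pigeonhole n<m with i , j , i<j , e ← Finₚ.pigeonhole n<m f̂ =
    element s i , element s j , element-P s i , element-P s j ,
    (λ eq → Finₚ.<⇒≢ i<j (element-injective s eq)) ,
    trans (sym (element-f̂ i)) (trans (cong (element t) e) (element-f̂ j))

module _ {A B C : Set} {P : A → Set} {Q : B → Set} {R : C → Set} {m n k}
         (s : HasSize P m) (t : HasSize Q n) (r : HasSize R k) (f : A → B → C)
         (f-maps : ∀ {x y} → P x → Q y → R (f x y))
         (f-inj : ∀ {x x′ y y′} → P x → P x′ → Q y → Q y′ → f x y ≡ f x′ y′ → x ≡ x′ × y ≡ y′) where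

  size-*-≤ : m * n ≤ k
  size-*-≤ = ×-injective⇒≤ f̂ f̂-injective
    where
    f̂ : Fin m × Fin n → Fin k
    f̂ (i , j) = index r (f-maps (element-P s i) (element-P t j))

    f̂-injective : ∀ {x y} → f̂ x ≡ f̂ y → x ≡ y
    f̂-injective {i , j} {i′ , j′} e
      with eᵢ , eⱼ ← f-inj (element-P s i) (element-P s i′) (element-P t j) (element-P t j′)
                           (index-injective r _ _ e)
      = cong₂ _,_ (element-injective s eᵢ) (element-injective t eⱼ)

module _ {A : Set} {P : A → Set} {m k n} (colour : A → Fin k) (s : HasSize P m)
         (part : ∀ b → HasSize (λ x → P x × colour x ≡ b) n) where

  private
    split : Fin m → Fin k × Fin n
    split i = colour (element s i) , index (part _) (element-P s i , refl)

    glue : Fin k × Fin n → Fin m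
    glue (b , j) = index s (proj₁ (element-P (part b) j))

    split-injective : ∀ {i i′} → split i ≡ split i′ → i ≡ i′
    split-injective {i} {i′} e = element-injective s (begin
      element s i                                  ≡⟨ element-index (part _) _ ⟨
      uncurry (λ b → element (part b)) (split i)   ≡⟨ cong (uncurry (λ b → element (part b))) e ⟩
      uncurry (λ b → element (part b)) (split i′)  ≡⟨ element-index (part _) _ ⟩
      element s i′                                 ∎)

    same-part : ∀ {b b′ j j′} → b ≡ b′ → element (part b) j ≡ element (part b′) j′ → (b , j) ≡ (b′ , j′)
    same-part refl eq = cong (_ ,_) (element-injective (part _) eq)

    glue-injective : ∀ {x y} → glue x ≡ glue y → x ≡ y
    glue-injective {b , j} {b′ , j′} e = same-part
      (trans (sym (proj₂ (element-P (part b) j))) (trans (cong colour eq) (proj₂ (element-P (part b′) j′))))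
      eq
      where
      eq : element (part b) j ≡ element (part b′) j′
      eq = index-injective s _ _ e

  partition-size : m ≡ k * n
  partition-size = ℕₚ.≤-antisym (injective-×⇒≤ split split-injective) (×-injective⇒≤ glue glue-injective)

module _ {A : Set} where

  HasSize-filter : ∀ {xs : List A} → Unique xs → (∀ x → x ∈ xs) →
                   {Q : A → Set} (Q? : Decidable Q) → HasSize Q (length (filter Q? xs))
  HasSize-filter {xs} xs! complete Q? = filter Q? xs , refl , Uniqueₚ.filter⁺ Q? xs! ,
    λ x → mk⇔ (∈-filter⁺ Q? (complete x)) (proj₂ ∘ ∈-filter⁻ Q? {xs = xs})

  HasSize-⊎ : ∀ {P Q : A → Set} {m n} → HasSize P m → HasSize Q n → (∀ {x} → P x → Q x → ⊥) →
              HasSize (λ x → P x ⊎ Q x) (m + n)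
  HasSize-⊎ (xs , refl , xs! , P⇔) (ys , refl , ys! , Q⇔) disjoint =
    xs ++ ys , Listₚ.length-++ xs ,
    Uniqueₚ.++⁺ xs! ys! (λ (x∈xs , x∈ys) → disjoint (from (P⇔ _) x∈xs) (from (Q⇔ _) x∈ys)) ,
    λ x → mk⇔ [ ∈-++⁺ˡ ∘ to (P⇔ x) , ∈-++⁺ʳ xs ∘ to (Q⇔ x) ]′
              (Sum.map (from (P⇔ x)) (from (Q⇔ x)) ∘ ∈-++⁻ xs)

  private
    ∈-pair : ∀ {w y₁ y₂ : A} → w ∈ y₁ ∷ y₂ ∷ [] → w ≡ y₁ ⊎ w ≡ y₂
    ∈-pair (here w≡y₁)         = inj₁ w≡y₁
    ∈-pair (there (here w≡y₂)) = inj₂ w≡y₂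

  HasSize-2 : ∀ {P : A → Set} → HasSize P 2 → ∀ {x} → P x →
              Σ A λ y → P y × x ≢ y × (∀ {w} → P w → w ≡ x ⊎ w ≡ y)
  HasSize-2 ([]            , () , _)
  HasSize-2 (_ ∷ []        , () , _)
  HasSize-2 (_ ∷ _ ∷ _ ∷ _ , () , _)
  HasSize-2 (y₁ ∷ y₂ ∷ [] , refl , (y₁≢y₂ ∷ []) ∷ _ , P⇔) {x} px with to (P⇔ x) px
  ... | here  refl        = y₂ , from (P⇔ y₂) (there (here refl)) , y₁≢y₂ ,
                            λ pw → ∈-pair (to (P⇔ _) pw)
  ... | there (here refl) = y₁ , from (P⇔ y₁) (here refl) , y₁≢y₂ ∘ sym ,
                            λ pw → Sum.swap (∈-pair (to (P⇔ _) pw))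

  all-or-counterexample : ∀ {P Q : A → Set} {n} → HasSize P n → Decidable Q →
                          (∀ {x} → P x → Q x) ⊎ ∃ λ x → P x × ¬ Q x
  all-or-counterexample (xs , _ , _ , P⇔) Q? with all? Q? xs
  ... | yes all-Q = inj₁ λ px → All.lookup all-Q (to (P⇔ _) px)
  ... | no ¬all-Q with x , x∈xs , ¬Qx ← find (¬All⇒Any¬ Q? xs ¬all-Q) = inj₂ (x , from (P⇔ x) x∈xs , ¬Qx)

infix 4 _≟ᵥ_ _≟ₘ_
_≟ᵥ_ : ∀ {n} → DecidableEquality (Vec F3 n)
_≟ᵥ_ = Vecₚ.≡-dec _≟₃_

_≟ₘ_ : DecidableEquality Mat
_≟ₘ_ = Vecₚ.≡-dec _≟ᵥ_

allVectors : ∀ n → List (Vec F3 n)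
allVectors ℕ.zero    = [] ∷ []
allVectors (ℕ.suc n) = List.cartesianProductWith _∷_ (𝟘 ∷ 𝟙 ∷ 𝟚 ∷ []) (allVectors n)

allVectors-complete : ∀ {n} (v : Vec F3 n) → v ∈ allVectors n
allVectors-complete []      = here refl
allVectors-complete (x ∷ v) = ∈-cartesianProductWith⁺ _∷_ (F3-complete x) (allVectors-complete v)
  where
  F3-complete : ∀ x → x ∈ 𝟘 ∷ 𝟙 ∷ 𝟚 ∷ []
  F3-complete 𝟘 = here refl
  F3-complete 𝟙 = there (here refl)
  F3-complete 𝟚 = there (there (here refl))

allVectors-unique : ∀ n → Unique (allVectors n)
allVectors-unique ℕ.zero    = [] ∷ []
allVectors-unique (ℕ.suc n) =
  Uniqueₚ.cartesianProductWith⁺ _∷_ Vecₚ.∷-injective F3-unique (allVectors-unique n)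
  where
  F3-unique : Unique (𝟘 ∷ 𝟙 ∷ 𝟚 ∷ [])
  F3-unique = ((λ ()) ∷ (λ ()) ∷ []) ∷ ((λ ()) ∷ []) ∷ [] ∷ []

-- Opaque blocks keep `with` and unification from normalising enumerations and proofs.
opaque
  V-size : HasSize (λ (_ : V) → ⊤) 81
  V-size = allVectors 4 , refl , allVectors-unique 4 , λ v → mk⇔ (λ _ → allVectors-complete v) (λ _ → tt)

  nonzero-size : HasSize (λ v → v ≢ 0V) 80
  nonzero-size = HasSize-filter (allVectors-unique 4) allVectors-complete (λ v → ¬? (v ≟ᵥ 0V))

  decidable⇒HasSize : {Q : V → Set} → Decidable Q → ∃ (HasSize Q)
  decidable⇒HasSize Q? = _ , HasSize-filter (allVectors-unique 4) allVectors-complete Q?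

Fixed Negated : Mat → V → Set
Fixed   a v = a · v ≡ v
Negated a v = a · v ≡ -ᵥ v

fixed×negated⇒0 : ∀ {a v} → Fixed a v → Negated a v → v ≡ 0V
fixed×negated⇒0 fixed negated = u≡-u⇒u≡0 (trans (sym fixed) negated)

¬-⇔ : ∀ {A B : Set} → A ⇔ B → (¬ A) ⇔ (¬ B)
¬-⇔ A⇔B = mk⇔ (λ ¬a → ¬a ∘ from A⇔B) (λ ¬b → ¬b ∘ to A⇔B)

exactly-one : ∀ {A B : Set} → (¬ (A × B) × (B ⊎ A)) ⇔ ((¬ A × B) ⊎ (A × ¬ B))
exactly-one = mk⇔
  (λ { (¬ab , inj₁ b) → inj₁ ((λ a → ¬ab (a , b)) , b)
     ; (¬ab , inj₂ a) → inj₂ (a , (λ b → ¬ab (a , b))) })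
  (λ { (inj₁ (¬a , b)) → (¬a ∘ proj₁) , inj₁ b
     ; (inj₂ (a , ¬b)) → (¬b ∘ proj₂) , inj₂ a })

module Eigenspaces (a : Mat) (a-involutive : ∀ v → a · (a · v) ≡ v) where

  -- The projections (1 ± a)/2, using 1/2 = −1 in F₃.
  P₊ P₋ : V → V
  P₊ v = -ᵥ (v +ᵥ a · v)
  P₋ v = -ᵥ (v -ᵥ a · v)

  P₊-fixed : ∀ v → Fixed a (P₊ v)
  P₊-fixed v = begin
    a · (-ᵥ (v +ᵥ a · v))     ≡⟨ ·--ᵥ a _ ⟩
    -ᵥ (a · (v +ᵥ a · v))     ≡⟨ cong -ᵥ_ (·-⊕ a v (a · v)) ⟩
    -ᵥ (a · v +ᵥ a · (a · v)) ≡⟨ cong (λ w → -ᵥ (a · v +ᵥ w)) (a-involutive v) ⟩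
    -ᵥ (a · v +ᵥ v)           ≡⟨ cong -ᵥ_ (+ᵥ-comm (a · v) v) ⟩
    -ᵥ (v +ᵥ a · v)           ∎

  P₋-negated : ∀ v → Negated a (P₋ v)
  P₋-negated v = begin
    a · (-ᵥ (v -ᵥ a · v))     ≡⟨ ·--ᵥ a _ ⟩
    -ᵥ (a · (v -ᵥ a · v))     ≡⟨ cong -ᵥ_ (·-distrib--ᵥ a v (a · v)) ⟩
    -ᵥ (a · v -ᵥ a · (a · v)) ≡⟨ cong (λ w → -ᵥ (a · v -ᵥ w)) (a-involutive v) ⟩
    -ᵥ (a · v -ᵥ v)           ≡⟨ -[u-v]≡v-u (a · v) v ⟩
    v -ᵥ a · v                ≡⟨ -ᵥ-involutive _ ⟨
    -ᵥ -ᵥ (v -ᵥ a · v)        ∎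

  P₊+P₋ : ∀ v → P₊ v +ᵥ P₋ v ≡ v
  P₊+P₋ v = -[u+v]+-[u-v]≡u v (a · v)

  a-fixed+negated : ∀ {p m} → Fixed a p → Negated a m → a · (p ⊕ m) ≡ p -ᵥ m
  a-fixed+negated {p} {m} ap≡p am≡-m = trans (·-⊕ a p m) (cong₂ _+ᵥ_ ap≡p am≡-m)

  P₊-fixed+negated : ∀ {p m} → Fixed a p → Negated a m → P₊ (p ⊕ m) ≡ p
  P₊-fixed+negated {p} {m} ap am =
    trans (cong (λ w → -ᵥ (p +ᵥ m +ᵥ w)) (a-fixed+negated ap am)) (-[[u+v]+[u-v]]≡u p m)

  P₋-fixed+negated : ∀ {p m} → Fixed a p → Negated a m → P₋ (p ⊕ m) ≡ m
  P₋-fixed+negated {p} {m} ap am =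
    trans (cong (λ w → -ᵥ (p +ᵥ m -ᵥ w)) (a-fixed+negated ap am)) (-[[u+v]-[u-v]]≡v p m)

  P₊-distrib--ᵥ : ∀ v u → P₊ (v -ᵥ u) ≡ P₊ v -ᵥ P₊ u
  P₊-distrib--ᵥ v u = trans (cong (λ w → -ᵥ (v -ᵥ u +ᵥ w)) (·-distrib--ᵥ a v u))
                            (-[[u-v]+[u′-v′]]≡-[u+u′]--[v+v′] v u (a · v) (a · u))

  P₋-distrib--ᵥ : ∀ v u → P₋ (v -ᵥ u) ≡ P₋ v -ᵥ P₋ u
  P₋-distrib--ᵥ v u = trans (cong (λ w → -ᵥ (v -ᵥ u -ᵥ w)) (·-distrib--ᵥ a v u))
                            (-[[u-v]-[u′-v′]]≡-[u-u′]--[v-v′] v u (a · v) (a · u))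

  0V-fixed : Fixed a 0V
  0V-fixed = ·-0V a

  0V-negated : Negated a 0V
  0V-negated = ·-0V a

  fixed⇔P₋≡0 : ∀ d → Fixed a d ⇔ P₋ d ≡ 0V
  fixed⇔P₋≡0 d = mk⇔
    (λ ad → trans (cong P₋ (sym (+ᵥ-identityʳ d))) (P₋-fixed+negated ad 0V-negated))
    (λ P₋d≡0 → subst (Fixed a) (P₊d≡d P₋d≡0) (P₊-fixed d))
    where
    P₊d≡d : P₋ d ≡ 0V → P₊ d ≡ d
    P₊d≡d P₋d≡0 = trans (sym (+ᵥ-identityʳ (P₊ d))) (trans (cong (P₊ d +ᵥ_) (sym P₋d≡0)) (P₊+P₋ d))

  negated⇔P₊≡0 : ∀ d → Negated a d ⇔ P₊ d ≡ 0V
  negated⇔P₊≡0 d = mk⇔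
    (λ ad → trans (cong P₊ (sym (+ᵥ-identityˡ d))) (P₊-fixed+negated 0V-fixed ad))
    (λ P₊d≡0 → subst (Negated a) (P₋d≡d P₊d≡0) (P₋-negated d))
    where
    P₋d≡d : P₊ d ≡ 0V → P₋ d ≡ d
    P₋d≡d P₊d≡0 = trans (sym (+ᵥ-identityˡ (P₋ d))) (trans (cong (_+ᵥ P₋ d) (sym P₊d≡0)) (P₊+P₋ d))

  P₊-≡⇔ : ∀ u v → P₊ (v -ᵥ u) ≡ 0V ⇔ P₊ u ≡ P₊ v
  P₊-≡⇔ u v = mk⇔
    (λ e → sym (u-v≡0⇒u≡v (trans (sym (P₊-distrib--ᵥ v u)) e)))
    (λ e → trans (P₊-distrib--ᵥ v u) (trans (cong (λ w → P₊ v -ᵥ w) e) (u-u≡0 (P₊ v))))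

  P₋-≡⇔ : ∀ u v → P₋ (v -ᵥ u) ≡ 0V ⇔ P₋ u ≡ P₋ v
  P₋-≡⇔ u v = mk⇔
    (λ e → sym (u-v≡0⇒u≡v (trans (sym (P₋-distrib--ᵥ v u)) e)))
    (λ e → trans (P₋-distrib--ᵥ v u) (trans (cong (λ w → P₋ v -ᵥ w) e) (u-u≡0 (P₋ v))))

  module _ (fixed-size : HasSize (Fixed a) 9) (negated-size : HasSize (Negated a) 9) where

    coordinates : V → Fin 9 × Fin 9
    coordinates v = index fixed-size (P₊-fixed v) , index negated-size (P₋-negated v)

    vector : Fin 9 × Fin 9 → V
    vector (i , j) = element fixed-size i ⊕ element negated-size j

    vector-coordinates : ∀ v → vector (coordinates v) ≡ v
    vector-coordinates v =
      trans (cong₂ _+ᵥ_ (element-index fixed-size _) (element-index negated-size _)) (P₊+P₋ v)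

    coordinates-vector : ∀ x → coordinates (vector x) ≡ x
    coordinates-vector (i , j) = cong₂ _,_
      (element-injective fixed-size (trans (element-index fixed-size _) (P₊-fixed+negated p m)))
      (element-injective negated-size (trans (element-index negated-size _) (P₋-fixed+negated p m)))
      where
      p : Fixed a (element fixed-size i)
      p = element-P fixed-size i

      m : Negated a (element negated-size j)
      m = element-P negated-size j

    private
      X Y : V → V → Set
      X u v = proj₁ (coordinates u) ≡ proj₁ (coordinates v)
      Y u v = proj₂ (coordinates u) ≡ proj₂ (coordinates v)

      ≡⇔X×Y : ∀ u v → u ≡ v ⇔ (X u v × Y u v)
      ≡⇔X×Y u v = mk⇔ (λ { refl → refl , refl })
        λ (x , y) → trans (sym (vector-coordinates u)) (trans (cong vector (cong₂ _,_ x y)) (vector-coordinates v))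

      negated⇔X : ∀ u v → Negated a (v -ᵥ u) ⇔ X u v
      negated⇔X u v = ⇔.trans (negated⇔P₊≡0 _) (⇔.trans (P₊-≡⇔ u v)
                        (mk⇔ (index-cong fixed-size _ _) (index-injective fixed-size _ _)))

      fixed⇔Y : ∀ u v → Fixed a (v -ᵥ u) ⇔ Y u v
      fixed⇔Y u v = ⇔.trans (fixed⇔P₋≡0 _) (⇔.trans (P₋-≡⇔ u v)
                      (mk⇔ (index-cong negated-size _ _) (index-injective negated-size _ _)))

    eigenspaces-isoToHamming : (R : V → V → Set) →
      (∀ u v → R u v ⇔ (u ≢ v × (Fixed a (v -ᵥ u) ⊎ Negated a (v -ᵥ u)))) → IsoToHamming R
    eigenspaces-isoToHamming R R⇔ = coordinates , vector , vector-coordinates , coordinates-vector ,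
      λ u v → ⇔.trans (R⇔ u v) (⇔.trans (¬-⇔ (≡⇔X×Y u v) ×-⇔ (fixed⇔Y u v ⊎-⇔ negated⇔X u v)) exactly-one)

·-inverse : ∀ {A B} → A ⊗ B ≡ I₄ → ∀ v → A · (B · v) ≡ v
·-inverse {A} {B} A⊗B≡I v = trans (sym (·-⊗ A B v)) (trans (cong (_· v) A⊗B≡I) (I₄-· v))

·-ext-I₄ : ∀ {A} → (∀ v → A · v ≡ v) → A ≡ I₄
·-ext-I₄ fixes = ·-ext λ v → trans (fixes v) (sym (I₄-· v))

Commute Anticommute : Mat → Mat → Set
Commute     A B = ∀ v → A · (B · v) ≡ B · (A · v)
Anticommute A B = ∀ v → A · (B · v) ≡ -ᵥ (B · (A · v))

Commute⇒⊗-comm : ∀ {A B} → Commute A B → A ⊗ B ≡ B ⊗ A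
Commute⇒⊗-comm {A} {B} comm = ·-ext λ v → trans (·-⊗ A B v) (trans (comm v) (sym (·-⊗ B A v)))

⊗-comm⇒Commute : ∀ {A B} → A ⊗ B ≡ B ⊗ A → Commute A B
⊗-comm⇒Commute {A} {B} eq v = trans (sym (·-⊗ A B v)) (trans (cong (_· v) eq) (·-⊗ B A v))

aff-0V : ∀ A t → aff A t 0V ≡ t
aff-0V A t = trans (cong (_⊕ t) (·-0V A)) (+ᵥ-identityˡ t)

aff-fixing-0V : ∀ {A t} → aff A t 0V ≡ 0V → ∀ v → aff A t v ≡ A · v
aff-fixing-0V {A} {t} fixes-0 v = trans (cong ((A · v) ⊕_) (trans (sym (aff-0V A t)) fixes-0)) (+ᵥ-identityʳ (A · v))

module _ {H : Mat → Set} (H-subgroup : IsSubgroupGL H) where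
  open IsSubgroupGL H-subgroup

  ·-injective : ∀ {A} → H A → ∀ {u v} → A · u ≡ A · v → u ≡ v
  ·-injective A∈H {u} {v} eq with B , _ , _ , B⊗A≡I ← inv∈ A∈H = begin
    u             ≡⟨ ·-inverse B⊗A≡I u ⟨
    B · (_ · u)   ≡⟨ cong (B ·_) eq ⟩
    B · (_ · v)   ≡⟨ ·-inverse B⊗A≡I v ⟩
    v             ∎

  ·-nonzero : ∀ {A} → H A → ∀ {v} → v ≢ 0V → A · v ≢ 0V
  ·-nonzero {A} A∈H v≢0 Av≡0 = v≢0 (·-injective A∈H (trans Av≡0 (sym (·-0V A))))

  I₄-central : Centre H I₄
  I₄-central = id∈ , λ x _ → Commute⇒⊗-comm λ v → trans (I₄-· (x · v)) (cong (x ·_) (sym (I₄-· v)))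

conjugate-· : ∀ A x A′ v → ((A ⊗ x) ⊗ A′) · v ≡ A · (x · (A′ · v))
conjugate-· A x A′ v = trans (·-⊗ (A ⊗ x) A′ v) (·-⊗ A x (A′ · v))

module Extraspecial {E : Mat → Set} (E-subgroup : IsSubgroupGL E) (E-extraspecial : IsExtraspecial32 E) where
  open IsExtraspecial32 E-extraspecial

  opaque
    centre : Σ Mat λ z → Centre E z × I₄ ≢ z × (∀ {x} → Centre E x → x ≡ I₄ ⊎ x ≡ z)
    centre = HasSize-2 centreSize (I₄-central E-subgroup)

  z : Mat
  z = proj₁ centre

  z-central : Centre E z
  z-central = proj₁ (proj₂ centre)

  I₄≢z : I₄ ≢ z
  I₄≢z = proj₁ (proj₂ (proj₂ centre))

  central⇒I₄⊎z : ∀ {x} → Centre E x → x ≡ I₄ ⊎ x ≡ z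
  central⇒I₄⊎z = proj₂ (proj₂ (proj₂ centre))

  z-involutive : ∀ v → z · (z · v) ≡ v
  z-involutive v with central⇒I₄⊎z (quotExp2 z (proj₁ z-central))
  ... | inj₁ z⊗z≡I = ·-inverse z⊗z≡I v
  ... | inj₂ z⊗z≡z = contradiction (sym (·-ext-I₄ z-fixes)) I₄≢z
    where
    z-fixes : ∀ w → z · w ≡ w
    z-fixes w = ·-injective E-subgroup (proj₁ z-central) (trans (sym (·-⊗ z z w)) (cong (_· w) z⊗z≡z))

  commute-or-twisted : ∀ {h x} → E h → E x → Commute h x ⊎ (∀ v → h · (x · v) ≡ x · (h · (z · v)))
  commute-or-twisted {h} {x} h∈E x∈E with z′ , z′-central , h⊗x≡x⊗h⊗z′ ← quotAbel h x h∈E x∈E =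
    Sum.map (λ { refl v → trans (twisted v) (cong (λ w → x · (h · w)) (I₄-· v)) })
            (λ { refl → twisted })
            (central⇒I₄⊎z z′-central)
    where
    twisted : ∀ v → h · (x · v) ≡ x · (h · (z′ · v))
    twisted v = begin
      h · (x · v)            ≡⟨ ·-⊗ h x v ⟨
      (h ⊗ x) · v            ≡⟨ cong (_· v) h⊗x≡x⊗h⊗z′ ⟩
      ((x ⊗ h) ⊗ z′) · v     ≡⟨ ·-⊗ (x ⊗ h) z′ v ⟩
      (x ⊗ h) · (z′ · v)     ≡⟨ ·-⊗ x h (z′ · v) ⟩
      x · (h · (z′ · v))     ∎

module CentralInvolution {G₀ E : Mat → Set} (G₀-subgroup : IsSubgroupGL G₀) (G-2-transitive : Affine2Transitive G₀)
       (E-subgroup : IsSubgroupGL E) (E⊴G₀ : IsNormalSubgroup E G₀) (E-extraspecial : IsExtraspecial32 E) where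
  open IsNormalSubgroup E⊴G₀
  open Extraspecial E-subgroup E-extraspecial public

  G₀-transitive : ∀ {v w} → v ≢ 0V → w ≢ 0V → Σ Mat λ A → G₀ A × A · v ≡ w
  G₀-transitive {v} {w} v≢0 w≢0
    with A , t , A∈G₀ , 0↦0 , v↦w ← G-2-transitive 0V v 0V w (v≢0 ∘ sym) (w≢0 ∘ sym)
    = A , A∈G₀ , trans (sym (aff-fixing-0V 0↦0 v)) v↦w

  conjugate-central : ∀ {A A′ x} → G₀ A → G₀ A′ → A ⊗ A′ ≡ I₄ → A′ ⊗ A ≡ I₄ →
                      Centre E x → Centre E ((A ⊗ x) ⊗ A′)
  conjugate-central {A} {A′} {x} A∈G₀ A′∈G₀ A⊗A′≡I A′⊗A≡I (x∈E , x-central) =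
    normal {A} {A′} A∈G₀ A⊗A′≡I x∈E , λ w w∈E → Commute⇒⊗-comm (commutes w w∈E)
    where
    commutes : ∀ w → E w → Commute ((A ⊗ x) ⊗ A′) w
    commutes w w∈E v = begin
      ((A ⊗ x) ⊗ A′) · (w · v)                ≡⟨ conjugate-· A x A′ (w · v) ⟩
      A · (x · (A′ · (w · v)))                ≡⟨ cong (λ u → A · (x · (A′ · (w · u)))) (·-inverse A⊗A′≡I v) ⟨
      A · (x · (A′ · (w · (A · (A′ · v)))))   ≡⟨ cong (λ u → A · (x · u)) (conjugate-· A′ w A (A′ · v)) ⟨
      A · (x · (w′ · (A′ · v)))               ≡⟨ cong (A ·_) (⊗-comm⇒Commute (x-central w′ w′∈E) (A′ · v)) ⟩
      A · (w′ · (x · (A′ · v)))               ≡⟨ cong (A ·_) (conjugate-· A′ w A (x · (A′ · v))) ⟩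
      A · (A′ · (w · (A · (x · (A′ · v)))))   ≡⟨ ·-inverse A⊗A′≡I _ ⟩
      w · (A · (x · (A′ · v)))                ≡⟨ cong (w ·_) (conjugate-· A x A′ v) ⟨
      w · (((A ⊗ x) ⊗ A′) · v)                ∎
      where
      w′ : Mat
      w′ = (A′ ⊗ w) ⊗ A

      w′∈E : E w′
      w′∈E = normal {A′} {A} A′∈G₀ A′⊗A≡I w∈E

  z-commutes-G₀ : ∀ {A} → G₀ A → Commute A z
  z-commutes-G₀ {A} A∈G₀ u with A′ , A′∈G₀ , A⊗A′≡I , A′⊗A≡I ← IsSubgroupGL.inv∈ G₀-subgroup A∈G₀ =
    [ (λ y≡I → contradiction (sym (·-ext-I₄ (z-fixes y≡I))) I₄≢z) , commutes ]′
    (central⇒I₄⊎z (conjugate-central A∈G₀ A′∈G₀ A⊗A′≡I A′⊗A≡I z-central))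
    where
    Az≡yA : ∀ v → A · (z · v) ≡ ((A ⊗ z) ⊗ A′) · (A · v)
    Az≡yA v = begin
      A · (z · v)                   ≡⟨ cong (λ w → A · (z · w)) (·-inverse A′⊗A≡I v) ⟨
      A · (z · (A′ · (A · v)))      ≡⟨ conjugate-· A z A′ (A · v) ⟨
      ((A ⊗ z) ⊗ A′) · (A · v)      ∎

    z-fixes : (A ⊗ z) ⊗ A′ ≡ I₄ → ∀ v → z · v ≡ v
    z-fixes y≡I v = ·-injective G₀-subgroup A∈G₀ (trans (Az≡yA v) (trans (cong (_· (A · v)) y≡I) (I₄-· (A · v))))

    commutes : (A ⊗ z) ⊗ A′ ≡ z → A · (z · u) ≡ z · (A · u)
    commutes y≡z = trans (Az≡yA u) (cong (_· (A · u)) y≡z)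

  z≡-1 : ∀ v → z · v ≡ -ᵥ v
  z≡-1 v with (z · v) ⊕ v ≟ᵥ 0V
  ... | yes zv+v≡0 = u+v≡0⇒u≡-v zv+v≡0
  ... | no  zv+v≢0 = contradiction (sym (·-ext-I₄ z-fixes)) I₄≢z
    where
    z-fixes-zv+v : z · ((z · v) ⊕ v) ≡ (z · v) ⊕ v
    z-fixes-zv+v = begin
      z · ((z · v) ⊕ v)          ≡⟨ ·-⊕ z (z · v) v ⟩
      (z · (z · v)) ⊕ (z · v)    ≡⟨ cong (_⊕ (z · v)) (z-involutive v) ⟩
      v ⊕ (z · v)                ≡⟨ +ᵥ-comm v (z · v) ⟩
      (z · v) ⊕ v                ∎

    z-fixes : ∀ y → z · y ≡ y
    z-fixes y with y ≟ᵥ 0V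
    ... | yes refl = ·-0V z
    ... | no  y≢0 with A , A∈G₀ , A[zv+v]≡y ← G₀-transitive zv+v≢0 y≢0 = begin
      z · y                     ≡⟨ cong (z ·_) A[zv+v]≡y ⟨
      z · (A · ((z · v) ⊕ v))   ≡⟨ z-commutes-G₀ A∈G₀ _ ⟨
      A · (z · ((z · v) ⊕ v))   ≡⟨ cong (A ·_) z-fixes-zv+v ⟩
      A · ((z · v) ⊕ v)         ≡⟨ A[zv+v]≡y ⟩
      y                         ∎

  commute-or-anticommute : ∀ {h x} → E h → E x → Commute h x ⊎ Anticommute h x
  commute-or-anticommute {h} {x} h∈E x∈E = Sum.map₂ anti (commute-or-twisted h∈E x∈E)
    where
    anti : (∀ v → h · (x · v) ≡ x · (h · (z · v))) → Anticommute h x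
    anti twisted v = begin
      h · (x · v)          ≡⟨ twisted v ⟩
      x · (h · (z · v))    ≡⟨ cong (λ w → x · (h · w)) (z≡-1 v) ⟩
      x · (h · (-ᵥ v))     ≡⟨ cong (x ·_) (·--ᵥ h v) ⟩
      x · (-ᵥ (h · v))     ≡⟨ ·--ᵥ x (h · v) ⟩
      -ᵥ (x · (h · v))     ∎

eigenspace-arithmetic : ∀ {q r₊ r₋} → q * q ≤ 81 → 16 ≤ r₊ + r₋ → r₊ < q → r₋ < q → q ≡ 9 × r₊ + r₋ ≤ 16
eigenspace-arithmetic {q} {r₊} {r₋} q²≤81 16≤r r₊<q r₋<q =
  ℕₚ.≤-antisym q≤9 9≤q , ℕₚ.+-mono-≤ (below q≤9 r₊<q) (below q≤9 r₋<q)
  where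
  below : ∀ {k r} → q ≤ ℕ.suc k → r < q → r ≤ k
  below q≤1+k r<q = ℕₚ.≤-pred (ℕₚ.≤-trans r<q q≤1+k)

  q≤9 : q ≤ 9
  q≤9 with q ≤? 9
  ... | yes q≤9 = q≤9
  ... | no  q≰9 = contradiction (ℕₚ.≤-trans (ℕₚ.*-mono-≤ (ℕₚ.≰⇒> q≰9) (ℕₚ.≰⇒> q≰9)) q²≤81) (from-no (100 ≤? 81))

  9≤q : 9 ≤ q
  9≤q with 9 ≤? q
  ... | yes 9≤q = 9≤q
  ... | no  9≰q = contradiction (ℕₚ.≤-trans 16≤r (ℕₚ.+-mono-≤ (below q≤8 r₊<q) (below q≤8 r₋<q))) (from-no (16 ≤? 14))
    where
    q≤8 : q ≤ 8
    q≤8 = ℕₚ.≤-pred (ℕₚ.≰⇒> 9≰q)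

module Factorisation
  {G₀ E : Mat → Set} {c : V → V → Fin 5}
  (G₀-subgroup : IsSubgroupGL G₀) (G-2-transitive : Affine2Transitive G₀)
  (E-subgroup : IsSubgroupGL E) (E⊴G₀ : IsNormalSubgroup E G₀) (E-extraspecial : IsExtraspecial32 E)
  (factorisation : IsHomFact5 G₀ c) (M⇔E : ∀ A t → Kernel G₀ c A t ⇔ E A)
  (M-arc-transitive : ∀ b → ArcTransitive (Kernel G₀ c) (FactorAdj c b)) where

  open IsHomFact5 factorisation
  open IsSubgroupGL E-subgroup using (id∈; mul∈; inv∈)
  open IsExtraspecial32 E-extraspecial using (order; quotExp2)
  open CentralInvolution G₀-subgroup G-2-transitive E-subgroup E⊴G₀ E-extraspecial

  colour : V → Fin 5
  colour = c 0V

  translation-invariant : ∀ t {u v} → u ≢ v → c (u ⊕ t) (v ⊕ t) ≡ c u v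
  translation-invariant t {u} {v} u≢v = subst₂ (λ x y → c (x ⊕ t) (y ⊕ t) ≡ c u v) (I₄-· u) (I₄-· v)
    (proj₂ (from (M⇔E I₄ t) id∈) u v u≢v)

  c≡colour : ∀ {u v} → u ≢ v → c u v ≡ colour (v -ᵥ u)
  c≡colour {u} {v} u≢v = begin
    c u v                  ≡⟨ translation-invariant (-ᵥ u) u≢v ⟨
    c (u -ᵥ u) (v -ᵥ u)    ≡⟨ cong (λ x → c x (v -ᵥ u)) (u-u≡0 u) ⟩
    colour (v -ᵥ u)        ∎

  E-preserves-colour : ∀ {A} → E A → ∀ {v} → v ≢ 0V → colour (A · v) ≡ colour v
  E-preserves-colour {A} A∈E {v} v≢0 =
    subst₂ (λ x y → c x y ≡ colour v) (aff-0V A 0V) (aff-fixing-0V (aff-0V A 0V) v)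
      (proj₂ (from (M⇔E A 0V) A∈E) 0V v (v≢0 ∘ sym))

  -- Part b is the connection set S_b of the factor Γ_b = Cay(V, S_b) (see c≡colour).
  Part : Fin 5 → V → Set
  Part b v = v ≢ 0V × colour v ≡ b

  part? : ∀ b → Decidable (Part b)
  part? b v = ¬? (v ≟ᵥ 0V) ×-dec colour v Fin.≟ b

  part-≤ : ∀ b b′ {m n} → HasSize (Part b) m → HasSize (Part b′) n → m ≤ n
  part-≤ b b′ s t with A , t′ , A∈G₀ , b↦b′ ← G-transParts b b′ =
    size-≤ s t (A ·_) maps (λ _ _ → ·-injective G₀-subgroup A∈G₀)
    where
    maps : MapsTo (A ·_) (Part b) (Part b′)
    maps {v} (v≢0 , colour-v≡b) = Av≢0 , (begin
      colour (A · v)                 ≡⟨ translation-invariant t′ (Av≢0 ∘ sym) ⟨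
      c (0V ⊕ t′) (aff A t′ v)       ≡⟨ cong (λ x → c x (aff A t′ v)) (trans (+ᵥ-identityˡ t′) (sym (aff-0V A t′))) ⟩
      c (aff A t′ 0V) (aff A t′ v)   ≡⟨ b↦b′ 0V v (v≢0 ∘ sym) colour-v≡b ⟩
      b′                             ∎)
      where
      Av≢0 : A · v ≢ 0V
      Av≢0 = ·-nonzero G₀-subgroup A∈G₀ v≢0

  -- The five parts are permuted transitively by G₀, so have equal sizes summing to 80.
  opaque
    part-size : ∀ b → HasSize (Part b) 16
    part-size b = subst (HasSize (Part b)) n≡16 (sizes b)
      where
      n : ℕ
      n = proj₁ (decidable⇒HasSize (part? zero))

      s₀ : HasSize (Part zero) n
      s₀ = proj₂ (decidable⇒HasSize (part? zero))

      sizes : ∀ b → HasSize (Part b) n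
      sizes b = subst (HasSize (Part b)) (ℕₚ.≤-antisym (part-≤ b zero sᵦ s₀) (part-≤ zero b s₀ sᵦ)) sᵦ
        where
        sᵦ : HasSize (Part b) (proj₁ (decidable⇒HasSize (part? b)))
        sᵦ = proj₂ (decidable⇒HasSize (part? b))

      n≡16 : n ≡ 16
      n≡16 = ℕₚ.*-cancelˡ-≡ n 16 5 (sym (partition-size colour nonzero-size sizes))

  module Factor (b : Fin 5) where

    opaque
      base : Σ V (Part b)
      base with u , v , u≢v , c≡b ← nonempty b = v -ᵥ u , u≢v⇒v-u≢0 u≢v , trans (sym (c≡colour u≢v)) c≡b

    s : V
    s = proj₁ base

    s≢0 : s ≢ 0V
    s≢0 = proj₁ (proj₂ base)

    colour-s : colour s ≡ b
    colour-s = proj₂ (proj₂ base)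

    s≢-s : s ≢ -ᵥ s
    s≢-s = s≢0 ∘ u≡-u⇒u≡0

    -- |E| = 32 > 16 = |Part b| and E acts on Part b, so the stabiliser of s in E is nontrivial.
    opaque
      stabiliser : Σ Mat λ a → E a × a ≢ I₄ × a · s ≡ s
      stabiliser = from-collision (pigeonhole order (part-size b) (_· s) E-maps (from-yes (16 <? 32)))
        where
        E-maps : MapsTo (_· s) E (Part b)
        E-maps A∈E = ·-nonzero E-subgroup A∈E s≢0 , trans (E-preserves-colour A∈E s≢0) colour-s

        from-collision : (∃₂ λ A B → E A × E B × A ≢ B × A · s ≡ B · s) → Σ Mat λ a → E a × a ≢ I₄ × a · s ≡ s
        from-collision (A , B , A∈E , B∈E , A≢B , As≡Bs)
          with B′ , B′∈E , B⊗B′≡I , B′⊗B≡I ← inv∈ B∈E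
          = B′ ⊗ A , mul∈ B′∈E A∈E , A≢B ∘ A≡B , B′As≡s
          where
          B′As≡s : (B′ ⊗ A) · s ≡ s
          B′As≡s = trans (·-⊗ B′ A s) (trans (cong (B′ ·_) As≡Bs) (·-inverse B′⊗B≡I s))

          A≡B : B′ ⊗ A ≡ I₄ → A ≡ B
          A≡B B′A≡I = ·-ext λ v → begin
            A · v                   ≡⟨ ·-inverse B⊗B′≡I (A · v) ⟨
            B · (B′ · (A · v))      ≡⟨ cong (B ·_) (·-⊗ B′ A v) ⟨
            B · ((B′ ⊗ A) · v)      ≡⟨ cong (λ M → B · (M · v)) B′A≡I ⟩
            B · (I₄ · v)            ≡⟨ cong (B ·_) (I₄-· v) ⟩
            B · v                   ∎

    a : Mat
    a = proj₁ stabiliser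

    a∈E : E a
    a∈E = proj₁ (proj₂ stabiliser)

    a≢I₄ : a ≢ I₄
    a≢I₄ = proj₁ (proj₂ (proj₂ stabiliser))

    as≡s : a · s ≡ s
    as≡s = proj₂ (proj₂ (proj₂ stabiliser))

    a-involutive : ∀ v → a · (a · v) ≡ v
    a-involutive v = [ (λ a⊗a≡I → ·-inverse {a} a⊗a≡I v) , (λ a⊗a≡z → contradiction (s≡-s a⊗a≡z) s≢-s) ]′
                     (central⇒I₄⊎z (quotExp2 a a∈E))
      where
      s≡-s : a ⊗ a ≡ z → s ≡ -ᵥ s
      s≡-s a⊗a≡z = begin
        s                 ≡⟨ as≡s ⟨
        a · s             ≡⟨ cong (a ·_) as≡s ⟨
        a · (a · s)       ≡⟨ ·-⊗ a a s ⟨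
        (a ⊗ a) · s       ≡⟨ cong (_· s) a⊗a≡z ⟩
        z · s             ≡⟨ z≡-1 s ⟩
        -ᵥ s              ∎

    a-not-central : ¬ Centre E a
    a-not-central a-central = [ a≢I₄ , (λ a≡z → s≢-s (trans (sym as≡s) (trans (cong (_· s) a≡z) (z≡-1 s)))) ]′
                              (central⇒I₄⊎z a-central)

    opaque
      partner : Σ Mat λ g → E g × Anticommute a g
      partner with all-or-counterexample order (λ x → a ⊗ x ≟ₘ x ⊗ a)
      ... | inj₁ all-commute = ⊥-elim (a-not-central (a∈E , λ _ x∈E → all-commute x∈E))
      ... | inj₂ (g , g∈E , ¬commute) =
        g , g∈E , [ (λ commute → ⊥-elim (¬commute (Commute⇒⊗-comm commute))) , id ]′
                      (commute-or-anticommute a∈E g∈E)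

    g : Mat
    g = proj₁ partner

    g∈E : E g
    g∈E = proj₁ (proj₂ partner)

    ag≡-ga : Anticommute a g
    ag≡-ga = proj₂ (proj₂ partner)

    part⊆eigenspaces : ∀ {w} → Part b w → Fixed a w ⊎ Negated a w
    part⊆eigenspaces {w} (w≢0 , colour-w)
      with A , t , A∈M , 0↦0 , s↦w ← M-arc-transitive b 0V s 0V w (s≢0 ∘ sym , colour-s) (w≢0 ∘ sym , colour-w) =
      Sum.map commuting anticommuting (commute-or-anticommute (to (M⇔E A t) A∈M) a∈E)
      where
      As≡w : A · s ≡ w
      As≡w = trans (sym (aff-fixing-0V 0↦0 s)) s↦w

      commuting : Commute A a → Fixed a w
      commuting Aa≡aA = begin
        a · w          ≡⟨ cong (a ·_) As≡w ⟨
        a · (A · s)    ≡⟨ Aa≡aA s ⟨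
        A · (a · s)    ≡⟨ cong (A ·_) as≡s ⟩
        A · s          ≡⟨ As≡w ⟩
        w              ∎

      anticommuting : Anticommute A a → Negated a w
      anticommuting Aa≡-aA = begin
        a · w              ≡⟨ cong (a ·_) As≡w ⟨
        a · (A · s)        ≡⟨ -ᵥ-involutive _ ⟨
        -ᵥ -ᵥ (a · (A · s)) ≡⟨ cong -ᵥ_ (Aa≡-aA s) ⟨
        -ᵥ (A · (a · s))   ≡⟨ cong (λ x → -ᵥ (A · x)) as≡s ⟩
        -ᵥ (A · s)         ≡⟨ cong -ᵥ_ As≡w ⟩
        -ᵥ w               ∎

    open Eigenspaces a a-involutive

    g-maps-fixed : MapsTo (g ·_) (Fixed a) (Negated a)
    g-maps-fixed {v} av≡v = trans (ag≡-ga v) (cong (λ w → -ᵥ (g · w)) av≡v)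

    g-maps-negated : MapsTo (g ·_) (Negated a) (Fixed a)
    g-maps-negated {v} av≡-v = begin
      a · (g · v)           ≡⟨ ag≡-ga v ⟩
      -ᵥ (g · (a · v))      ≡⟨ cong (λ w → -ᵥ (g · w)) av≡-v ⟩
      -ᵥ (g · (-ᵥ v))       ≡⟨ cong -ᵥ_ (·--ᵥ g v) ⟩
      -ᵥ -ᵥ (g · v)         ≡⟨ -ᵥ-involutive (g · v) ⟩
      g · v                 ∎

    g-injective : ∀ {P} → InjectiveOn (g ·_) P
    g-injective _ _ = ·-injective E-subgroup g∈E

    private
      Fixed⁺ Negated⁺ : V → Set
      Fixed⁺   v = v ≢ 0V × Fixed a v
      Negated⁺ v = v ≢ 0V × Negated a v

      fixed-size′ : ∃ (HasSize (Fixed a))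
      fixed-size′ = decidable⇒HasSize λ v → a · v ≟ᵥ v

      negated-size′ : ∃ (HasSize (Negated a))
      negated-size′ = decidable⇒HasSize λ v → a · v ≟ᵥ -ᵥ v

      fixed⁺-size : ∃ (HasSize Fixed⁺)
      fixed⁺-size = decidable⇒HasSize λ v → ¬? (v ≟ᵥ 0V) ×-dec a · v ≟ᵥ v

      negated⁺-size : ∃ (HasSize Negated⁺)
      negated⁺-size = decidable⇒HasSize λ v → ¬? (v ≟ᵥ 0V) ×-dec a · v ≟ᵥ -ᵥ v

      q₊ q₋ r₊ r₋ : ℕ
      q₊ = proj₁ fixed-size′
      q₋ = proj₁ negated-size′
      r₊ = proj₁ fixed⁺-size
      r₋ = proj₁ negated⁺-size

      eigen⁺-size : HasSize (λ v → Fixed⁺ v ⊎ Negated⁺ v) (r₊ + r₋)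
      eigen⁺-size = HasSize-⊎ (proj₂ fixed⁺-size) (proj₂ negated⁺-size)
        λ (v≢0 , fixed) (_ , negated) → v≢0 (fixed×negated⇒0 fixed negated)

      part⊆eigen⁺ : MapsTo id (Part b) (λ v → Fixed⁺ v ⊎ Negated⁺ v)
      part⊆eigen⁺ w∈part = Sum.map (proj₁ w∈part ,_) (proj₁ w∈part ,_) (part⊆eigenspaces w∈part)

      q₊≡q₋ : q₊ ≡ q₋
      q₊≡q₋ = ℕₚ.≤-antisym (size-≤ (proj₂ fixed-size′) (proj₂ negated-size′) (g ·_) g-maps-fixed g-injective)
                            (size-≤ (proj₂ negated-size′) (proj₂ fixed-size′) (g ·_) g-maps-negated g-injective)

      -- V = Fixed a ⊕ Negated a, so (p , m) ↦ p + m is injective.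
      q₊q₋≤81 : q₊ * q₋ ≤ 81
      q₊q₋≤81 = size-*-≤ (proj₂ fixed-size′) (proj₂ negated-size′) V-size _⊕_ (λ _ _ → tt)
        λ p p′ m m′ eq → trans (sym (P₊-fixed+negated p m)) (trans (cong P₊ eq) (P₊-fixed+negated p′ m′)) ,
                          trans (sym (P₋-fixed+negated p m)) (trans (cong P₋ eq) (P₋-fixed+negated p′ m′))

      r₊<q₊ : r₊ < q₊
      r₊<q₊ = size-< (proj₂ fixed⁺-size) (proj₂ fixed-size′) id proj₂ (λ _ _ → id) 0V-fixed proj₁

      r₋<q₋ : r₋ < q₋
      r₋<q₋ = size-< (proj₂ negated⁺-size) (proj₂ negated-size′) id proj₂ (λ _ _ → id) 0V-negated proj₁

      16≤r₊+r₋ : 16 ≤ r₊ + r₋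
      16≤r₊+r₋ = size-≤ (part-size b) eigen⁺-size id part⊆eigen⁺ (λ _ _ → id)

      counting : q₊ ≡ 9 × r₊ + r₋ ≤ 16
      counting = eigenspace-arithmetic (subst (λ q → q₊ * q ≤ 81) (sym q₊≡q₋) q₊q₋≤81) 16≤r₊+r₋ r₊<q₊
                                       (subst (r₋ <_) (sym q₊≡q₋) r₋<q₋)

    fixed-size : HasSize (Fixed a) 9
    fixed-size = subst (HasSize (Fixed a)) (proj₁ counting) (proj₂ fixed-size′)

    negated-size : HasSize (Negated a) 9
    negated-size = subst (HasSize (Negated a)) (trans (sym q₊≡q₋) (proj₁ counting)) (proj₂ negated-size′)

    eigenspaces⊆part : ∀ {w} → w ≢ 0V → Fixed a w ⊎ Negated a w → Part b w
    eigenspaces⊆part {w} w≢0 eigen with colour w Fin.≟ b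
    ... | yes colour-w = w≢0 , colour-w
    ... | no  colour-w≢b = contradiction (proj₂ counting) (ℕₚ.<⇒≱ 16<r₊+r₋)
      where
      16<r₊+r₋ : 16 < r₊ + r₋
      16<r₊+r₋ = size-< (part-size b) eigen⁺-size id part⊆eigen⁺ (λ _ _ → id)
        (Sum.map (w≢0 ,_) (w≢0 ,_) eigen)
        λ (_ , colour-x) x≡w → colour-w≢b (subst (λ y → colour y ≡ b) x≡w colour-x)

    factor-adjacency : ∀ u v → FactorAdj c b u v ⇔ (u ≢ v × (Fixed a (v -ᵥ u) ⊎ Negated a (v -ᵥ u)))
    factor-adjacency u v = mk⇔
      (λ (u≢v , c≡b) → u≢v , part⊆eigenspaces (u≢v⇒v-u≢0 u≢v , trans (sym (c≡colour u≢v)) c≡b))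
      (λ (u≢v , eigen) → u≢v , trans (c≡colour u≢v) (proj₂ (eigenspaces⊆part (u≢v⇒v-u≢0 u≢v) eigen)))

theorem6p9 : (G₀ E : Mat → Set) (c : V → V → Fin 5) →
    IsSubgroupGL G₀ →
    Affine2Transitive G₀ →
    IsSubgroupGL E →
    IsNormalSubgroup E G₀ →
    IsExtraspecial32 E →
    QuotEmbedsS5 G₀ E →
    IsHomFact5 G₀ c →
    (∀ A t → (Kernel G₀ c A t ⇔ E A)) →
    (∀ b → ArcTransitive (Kernel G₀ c) (FactorAdj c b)) →
    ∀ b → IsoToHamming (FactorAdj c b)
theorem6p9 G₀ E c G₀-subgroup G-2-transitive E-subgroup E⊴G₀ E-extraspecial _ factorisation M⇔E M-arc-transitive b =
  Eigenspaces.eigenspaces-isoToHamming a a-involutive fixed-size negated-size (FactorAdj c b) factor-adjacency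
  where
  open Factorisation G₀-subgroup G-2-transitive E-subgroup E⊴G₀ E-extraspecial factorisation M⇔E M-arc-transitive
  open Factor b
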